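{- Let $\mathsf{P}(t,y)$ be the generating function of patches and $\mathsf{C}(t,x,y)$ the generating function of C-patches (as defined in the context). Then \[ \mathsf{P}(t,y)=\frac1y[x^1]\mathsf{C}(t,x,y). \]
   Context: A rooted planar map has an oriented root edge; its starting point is the root vertex, its endpoint the co-root vertex; the face to the right of the root edge is the root (outer) face, the others are inner faces; the outer degree is the degree of the outer face; the root corner is the corner at the root vertex lying in the outer face immediately before the root edge in anticlockwise order around the root vertex. A labelled map is a rooted planar map with integer vertex labels such that adjacent labels differ by $\pm1$ and the root edge goes from label $0$ to label $1$; the atomic map (one vertex labelled $0$) is a labelled map. A patch is a labelled map in which every inner face has degree $4$ (an inner quadrangle) and the vertices around the outer face are alternately labelled $0$ and $1$. A C-patch is a patch in which all neighbours of the root vertex are labelled $1$ and the root corner is the only outer corner at the root vertex; the atomic map is not a C-patch. $\mathsf{P}(t,y)=\sum_P t^{\#\text{inner quadrangles}}y^{\text{outer degree}/2}$ over patches, and $\mathsf{C}(t,x,y)=\sum_C t^{\#\text{inner quadrangles}}x^{\deg(\text{root vertex})}y^{\text{outer degree}/2}$ over C-patches. $[x^1]F$ denotes the coefficient of $x^1$ in $F$, as a series in the other variables. -}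

module Defs where

open import Data.Nat using (ℕ; zero; suc; _+_; _*_; _∸_; _≤_; _≤?_)
open import Data.Integer using (ℤ; 0ℤ; 1ℤ) renaming (_+_ to _+ℤ_; _-_ to _-ℤ_)
open import Data.Fin using (Fin; toℕ)
open import Data.Fin.Properties using (_≟_)
open import Data.Fin.Permutation using (Permutation; Permutation′; _⟨$⟩ʳ_)
open import Data.List using (List; map; upTo; length; filter; allFin)
open import Data.List.Relation.Unary.All using (All; all?)
import Data.List.Membership.DecPropositional as DM
open import Data.Product using (Σ; _×_; _,_)
open import Data.Sum using (_⊎_)
open import Data.Empty using (⊥)
open import Relation.Binary.PropositionalEquality using (_≡_; _≢_)
open import Relation.Nullary using (¬_)

iter : ∀ {d} → (Fin d → Fin d) → ℕ → Fin d → Fin d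
iter f zero    h = h
iter f (suc i) h = f (iter f i h)

orbitList : ∀ {d} → (Fin d → Fin d) → Fin d → List (Fin d)
orbitList {d} f h = map (λ i → iter f i h) (upTo d)

InOrbit : ∀ {d} → (Fin d → Fin d) → Fin d → Fin d → Set
InOrbit {d} f h j = Σ ℕ (λ i → iter f i h ≡ j)

orbitSize : ∀ {d} → (Fin d → Fin d) → Fin d → ℕ
orbitSize {d} f h = length (filter (λ j → j ∈? orbitList f h) (allFin d))
  where open DM (_≟_ {d}) using (_∈?_)

numCycles : ∀ {d} → (Fin d → Fin d) → ℕ
numCycles {d} f = length (filter (λ h → all? (λ j → toℕ h ≤? toℕ j) (orbitList f h)) (allFin d))

-- Non-atomic labelled maps as combinatorial maps on d darts.
-- σ : rotation of darts anticlockwise around their vertex (vertices = σ-orbits)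
-- α : fixed-point-free involution pairing the two darts of an edge
-- φ = σ ∘ α : the face permutation; the φ-orbit of a dart h is the face
--             to the right of h; the corner (σ⁻¹ h, h) lies in that face.
-- r : root dart (from the root vertex to the co-root vertex).
-- lab : labels on darts, constant on vertices (σ-orbits).

data Reach {d : ℕ} (s a : Fin d → Fin d) (r : Fin d) : Fin d → Set where
  base : Reach s a r r
  vias : ∀ {h} → Reach s a r h → Reach s a r (s h)
  viaa : ∀ {h} → Reach s a r h → Reach s a r (a h)

record LMap (d : ℕ) : Set where
  field
    σ        : Permutation′ d
    α        : Fin d → Fin d
    α-invol  : ∀ h → α (α h) ≡ h
    α-fpf    : ∀ h → α h ≢ h
    r        : Fin d
    lab      : Fin d → ℤ

  φ : Fin d → Fin d
  φ h = σ ⟨$⟩ʳ (α h)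

  field
    connected : ∀ h → Reach (σ ⟨$⟩ʳ_) α r h
    -- Euler: V - E + F = 2 with 2E = d
    planar    : 2 * (numCycles (σ ⟨$⟩ʳ_) + numCycles φ) ≡ d + 4
    lab-vertex : ∀ h → lab (σ ⟨$⟩ʳ h) ≡ lab h
    lab-edge   : ∀ h → (lab (α h) ≡ lab h +ℤ 1ℤ) ⊎ (lab (α h) ≡ lab h -ℤ 1ℤ)
    lab-root   : (lab r ≡ 0ℤ) × (lab (α r) ≡ 1ℤ)

-- A labelled map: the atomic map, or a map with at least one edge.
data LabelledMap : Set where
  atomic    : LabelledMap
  nonatomic : (d : ℕ) → LMap d → LabelledMap

data _≅_ : LabelledMap → LabelledMap → Set where
  atomic≅ : atomic ≅ atomic
  map≅    : ∀ {d d'} {M : LMap d} {N : LMap d'} (f : Permutation d d') →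
            (∀ h → f ⟨$⟩ʳ (LMap.σ M ⟨$⟩ʳ h) ≡ LMap.σ N ⟨$⟩ʳ (f ⟨$⟩ʳ h)) →
            (∀ h → f ⟨$⟩ʳ (LMap.α M h) ≡ LMap.α N (f ⟨$⟩ʳ h)) →
            f ⟨$⟩ʳ LMap.r M ≡ LMap.r N →
            (∀ h → LMap.lab N (f ⟨$⟩ʳ h) ≡ LMap.lab M h) →
            nonatomic d M ≅ nonatomic d' N

innerFaces : LabelledMap → ℕ
innerFaces atomic = 0
innerFaces (nonatomic d M) = numCycles (LMap.φ M) ∸ 1

outerDegree : LabelledMap → ℕ
outerDegree atomic = 0
outerDegree (nonatomic d M) = orbitSize (LMap.φ M) (LMap.r M)

rootDegree : LabelledMap → ℕ
rootDegree atomic = 0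
rootDegree (nonatomic d M) = orbitSize (LMap.σ M ⟨$⟩ʳ_) (LMap.r M)

-- every inner face has degree 4; outer vertices alternately labelled 0 and 1
IsPatch : LabelledMap → Set
IsPatch atomic = Data.Unit.⊤ where import Data.Unit
IsPatch (nonatomic d M) =
  (∀ h → ¬ InOrbit φ r h → orbitSize φ h ≡ 4) ×
  (∀ h → InOrbit φ r h →
     ((lab h ≡ 0ℤ) × (lab (α h) ≡ 1ℤ)) ⊎ ((lab h ≡ 1ℤ) × (lab (α h) ≡ 0ℤ)))
  where open LMap M

IsCPatch : LabelledMap → Set
IsCPatch atomic = ⊥
IsCPatch (nonatomic d M) =
  IsPatch (nonatomic d M) ×
  (∀ h → InOrbit (σ ⟨$⟩ʳ_) r h → lab (α h) ≡ 1ℤ) ×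
  -- the root corner is the only outer corner at the root vertex
  (∀ h → InOrbit (σ ⟨$⟩ʳ_) r h → InOrbit φ r h → h ≡ r)
  where open LMap M

-- Patches with n inner quadrangles and outer degree 2k  (coefficient [t^n y^k] P)
PatchNK : ℕ → ℕ → LabelledMap → Set
PatchNK n k M = IsPatch M × (innerFaces M ≡ n) × (outerDegree M ≡ 2 * k)

-- C-patches with n inner quadrangles, root degree j, outer degree 2k
-- (coefficient [t^n x^j y^k] C)
CPatchNJK : ℕ → ℕ → ℕ → LabelledMap → Set
CPatchNJK n j k M = IsCPatch M × (innerFaces M ≡ n) × (rootDegree M ≡ j) × (outerDegree M ≡ 2 * k)

-- Equality of (possibly) counted classes: a bijection between the
-- isomorphism classes of the two families, given as maps in both
-- directions compatible with ≅ and mutually inverse up to ≅.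

record ClassBijection (A B : LabelledMap → Set) : Set where
  field
    to        : ∀ M → A M → Σ LabelledMap B
    from      : ∀ M → B M → Σ LabelledMap A
    to-cong   : ∀ M M' (p : A M) (p' : A M') → M ≅ M' →
                Σ.proj₁ (to M p) ≅ Σ.proj₁ (to M' p')
    from-cong : ∀ M M' (p : B M) (p' : B M') → M ≅ M' →
                Σ.proj₁ (from M p) ≅ Σ.proj₁ (from M' p')
    from-to   : ∀ M (p : A M) → Σ.proj₁ (from (Σ.proj₁ (to M p)) (Σ.proj₂ (to M p))) ≅ M
    to-from   : ∀ M (p : B M) → Σ.proj₁ (to (Σ.proj₁ (from M p)) (Σ.proj₂ (from M p))) ≅ M

module Submission where

-- Coefficientwise, patches with n inner quadrangles and outer degree 2k
-- correspond bijectively, up to isomorphism, to C-patches with n inner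
-- quadrangles, root degree 1 and outer degree 2(k + 1); and no C-patch has
-- outer degree 0.  The bijection adds a pendant root edge: a new root vertex
-- labelled 0 is joined to the old co-root vertex (labelled 1), the new dart
-- there being placed right after the old root edge.  Its inverse deletes the
-- root edge of a C-patch of root degree 1; the atomic patch corresponds to
-- the single edge.  Adding the edge creates one vertex and no face, keeps
-- every inner face, and lengthens the root face by 2.

open import Defs
open import Data.Nat using (ℕ; zero; suc; _+_; _*_; _∸_; _≤_; _<_; _≤?_; z≤n; s≤s)
open import Data.Nat.Properties
  using (+-assoc; +-comm; +-suc; 1+n≢0; suc-injective; ≤-pred; ≤-trans; ≤-reflexive; ≤-antisym;
         <-irrefl; <-≤-trans; <⇒≤; n<1+n;
         +-∸-assoc; m∸n≤m; m+[n∸m]≡n; *-suc; +-cancelˡ-≡; +-commutativeSemigroup)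
open import Data.Nat.DivMod using (_%_; _/_; m≡m%n+[m/n]*n; m%n<n)
open import Algebra.Properties.CommutativeSemigroup +-commutativeSemigroup using (interchange; x∙yz≈y∙xz)
open import Data.Fin using (Fin; toℕ; punchIn; punchOut) renaming (zero to fz; suc to fs)
open import Data.Fin.Properties
  using (_≟_; toℕ-injective; toℕ<n; ¬Fin0; pigeonhole; any?; punchIn-injective; punchInᵢ≢i;
         punchIn-punchOut; punchOut-injective; punchIn-mono-≤; punchIn-cancel-≤)
  renaming (suc-injective to fs-injective)
open import Data.List using (filter; length; tabulate)
open import Data.List.Relation.Unary.All as All using (All; all?)
open import Data.List.Membership.Propositional using (_∈_)
open import Data.List.Membership.Propositional.Properties using (∈-map⁺; ∈-map⁻; ∈-upTo⁺)
import Data.List.Membership.DecPropositional as DecMembership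
open import Data.Product using (Σ; _×_; _,_; proj₁; proj₂)
open import Data.Sum using (_⊎_; inj₁; inj₂)
open import Data.Empty using (⊥; ⊥-elim)
open import Function using (_∘_; id)
open import Function.Definitions using (Injective)
open import Data.Integer using (ℤ; 0ℤ; 1ℤ) renaming (_+_ to _+ℤ_; _-_ to _-ℤ_)
import Data.Fin.Permutation
open import Data.Fin.Permutation
  using (Permutation; Permutation′; _⟨$⟩ʳ_; _⟨$⟩ˡ_; permutation; inverseˡ; inverseʳ; transpose; lift₀; _∘ₚ_)
open import Relation.Binary.PropositionalEquality
open import Relation.Nullary using (¬_; Dec; yes; no)
open import Relation.Nullary.Decidable using (map′)
open import Relation.Unary using (Decidable)
open import Relation.Unary.Properties using (_∩?_; ∁?)

ind : ∀ {A : Set} → Dec A → ℕ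
ind (yes _) = 1
ind (no _)  = 0

ind-yes : ∀ {A : Set} (a? : Dec A) → A → ind a? ≡ 1
ind-yes (yes _) _ = refl
ind-yes (no ¬a) a = ⊥-elim (¬a a)

ind-no : ∀ {A : Set} (a? : Dec A) → ¬ A → ind a? ≡ 0
ind-no (yes a) ¬a = ⊥-elim (¬a a)
ind-no (no _)  _  = refl

count : ∀ {n} {P : Fin n → Set} → Decidable P → ℕ
count {zero}  P? = 0
count {suc n} P? = ind (P? fz) + count (λ i → P? (fs i))

length-filter-tabulate : ∀ {A : Set} {Q : A → Set} (Q? : Decidable Q) {n} (g : Fin n → A) →
  length (filter Q? (tabulate g)) ≡ count (λ i → Q? (g i))
length-filter-tabulate Q? {zero}  g = refl
length-filter-tabulate Q? {suc n} g with Q? (g fz)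
... | yes _ = cong suc (length-filter-tabulate Q? (g ∘ fs))
... | no _  = length-filter-tabulate Q? (g ∘ fs)

count-cong : ∀ {n} {P Q : Fin n → Set} (P? : Decidable P) (Q? : Decidable Q) →
  (∀ i → P i → Q i) → (∀ i → Q i → P i) → count P? ≡ count Q?
count-cong {zero}  P? Q? to from = refl
count-cong {suc n} {P} {Q} P? Q? to from =
  cong₂ _+_ (ind-agree (P? fz) (Q? fz)) (count-cong (P? ∘ fs) (Q? ∘ fs) (to ∘ fs) (from ∘ fs))
  where
  ind-agree : (p? : Dec (P fz)) (q? : Dec (Q fz)) → ind p? ≡ ind q?
  ind-agree (yes _) (yes _) = refl
  ind-agree (no _)  (no _)  = refl
  ind-agree (yes p) (no ¬q) = ⊥-elim (¬q (to fz p))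
  ind-agree (no ¬p) (yes q) = ⊥-elim (¬p (from fz q))

count-split : ∀ {n} {P R : Fin n → Set} (P? : Decidable P) (R? : Decidable R) →
  count P? ≡ count (P? ∩? R?) + count (P? ∩? ∁? R?)
count-split {zero}  P? R? = refl
count-split {suc n} {P} {R} P? R? =
  begin
    ind (P? fz) + count (P? ∘ fs)
  ≡⟨ cong₂ _+_ ind-split (count-split (P? ∘ fs) (R? ∘ fs)) ⟩
    (ind ((P? ∩? R?) fz) + ind ((P? ∩? ∁? R?) fz)) + (count ((P? ∩? R?) ∘ fs) + count ((P? ∩? ∁? R?) ∘ fs))
  ≡⟨ interchange (ind ((P? ∩? R?) fz)) (ind ((P? ∩? ∁? R?) fz))
                 (count ((P? ∩? R?) ∘ fs)) (count ((P? ∩? ∁? R?) ∘ fs)) ⟩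
    count (P? ∩? R?) + count (P? ∩? ∁? R?)
  ∎
  where
  open ≡-Reasoning
  ind-split : ind (P? fz) ≡ ind ((P? ∩? R?) fz) + ind ((P? ∩? ∁? R?) fz)
  ind-split with P? fz | R? fz
  ... | yes _ | yes _ = refl
  ... | yes _ | no _  = refl
  ... | no _  | _     = refl

count-none : ∀ {n} {P : Fin n → Set} (P? : Decidable P) → (∀ i → ¬ P i) → count P? ≡ 0
count-none {zero}  P? none = refl
count-none {suc n} P? none = cong₂ _+_ (ind-no (P? fz) (none fz)) (count-none (P? ∘ fs) (none ∘ fs))

count-punchIn : ∀ {n} {P : Fin (suc n) → Set} (P? : Decidable P) (x : Fin (suc n)) →
  count P? ≡ ind (P? x) + count (λ i → P? (punchIn x i))
count-punchIn P? fz = refl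
count-punchIn {suc n} P? (fs x) =
  begin
    ind (P? fz) + count (P? ∘ fs)
  ≡⟨ cong (ind (P? fz) +_) (count-punchIn (P? ∘ fs) x) ⟩
    ind (P? fz) + (ind (P? (fs x)) + count (λ i → P? (fs (punchIn x i))))
  ≡⟨ x∙yz≈y∙xz (ind (P? fz)) (ind (P? (fs x))) (count (λ i → P? (fs (punchIn x i)))) ⟩
    ind (P? (fs x)) + count (λ i → P? (punchIn (fs x) i))
  ∎
  where open ≡-Reasoning

count-witness : ∀ {n} {P : Fin (suc n) → Set} (P? : Decidable P) {m} → P m →
  count P? ≡ suc (count (λ i → P? (punchIn m i)))
count-witness P? {m} pm = trans (count-punchIn P? m) (cong (_+ count (λ i → P? (punchIn m i))) (ind-yes (P? m) pm))

count-unique : ∀ {n} {P : Fin n → Set} (P? : Decidable P) {m} → P m → (∀ i → P i → i ≡ m) → count P? ≡ 1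
count-unique {suc n} P? {m} pm unique =
  trans (count-witness P? pm) (cong suc (count-none _ (λ i pi → punchInᵢ≢i m i (unique _ pi))))

count-two : ∀ {n} {P : Fin n → Set} (P? : Decidable P) {i j} → i ≢ j → P i → P j → 2 ≤ count P?
count-two {suc zero} P? {fz} {fz} i≢j _ _ = ⊥-elim (i≢j refl)
count-two {suc (suc n)} {P} P? {i} {j} i≢j pi pj
  rewrite count-witness P? pi | count-witness (λ k → P? (punchIn i k)) (subst P (sym (punchIn-punchOut i≢j)) pj)
  = s≤s (s≤s z≤n)

least-witness : ∀ {n} {P : Fin n → Set} (P? : Decidable P) {m} → P m →
  Σ (Fin n) λ j → P j × (∀ i → P i → toℕ j ≤ toℕ i)
least-witness {suc n} P? {m} pm with P? fz
... | yes p0 = fz , p0 , λ _ _ → z≤n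
least-witness {suc n} P? {fz}   pm | no ¬p0 = ⊥-elim (¬p0 pm)
least-witness {suc n} P? {fs m} pm | no ¬p0 with least-witness (P? ∘ fs) pm
... | j , pj , least = fs j , pj , λ { fz p0 → ⊥-elim (¬p0 p0) ; (fs i) pi → s≤s (least i pi) }

module _ {n : ℕ} (f : Fin n → Fin n) where

  iter-+ : ∀ a b h → iter f (a + b) h ≡ iter f a (iter f b h)
  iter-+ zero    b h = refl
  iter-+ (suc a) b h = cong f (iter-+ a b h)

  iter-shift : ∀ k h → iter f k (f h) ≡ f (iter f k h)
  iter-shift zero    h = refl
  iter-shift (suc k) h = cong f (iter-shift k h)

  orbit-refl : ∀ h → InOrbit f h h
  orbit-refl h = 0 , refl

  orbit-step : ∀ h → InOrbit f h (f h)
  orbit-step h = 1 , refl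

  orbit-trans : ∀ {h j l} → InOrbit f h j → InOrbit f j l → InOrbit f h l
  orbit-trans (i , refl) (k , refl) = k + i , iter-+ k i _

  fixed-orbit : ∀ {h z} → f h ≡ h → InOrbit f h z → z ≡ h
  fixed-orbit {h} fh≡h (i , refl) = iter-fixed i
    where
    iter-fixed : ∀ i → iter f i h ≡ h
    iter-fixed zero    = refl
    iter-fixed (suc i) = trans (cong f (iter-fixed i)) fh≡h

  IsLeast : Fin n → Set
  IsLeast h = ∀ j → InOrbit f h j → toℕ h ≤ toℕ j

module Orbits {n : ℕ} (f : Fin n → Fin n) (f-inj : Injective _≡_ _≡_ f) where

  iter-injective : ∀ k {h h'} → iter f k h ≡ iter f k h' → h ≡ h'
  iter-injective zero    e = e
  iter-injective (suc k) e = iter-injective k (f-inj e)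

  period : ∀ h → Σ ℕ λ p → suc p ≤ n × iter f (suc p) h ≡ h
  period h with pigeonhole (n<1+n n) (λ (i : Fin (suc n)) → iter f (toℕ i) h)
  ... | i , j , i<j , e = p , p<n , iter-injective (toℕ i) returns
    where
    open ≡-Reasoning
    p : ℕ
    p = toℕ j ∸ suc (toℕ i)
    suc-p : suc p ≡ toℕ j ∸ toℕ i
    suc-p = sym (+-∸-assoc 1 i<j)
    p<n : suc p ≤ n
    p<n = subst (_≤ n) (sym suc-p) (≤-trans (m∸n≤m (toℕ j) (toℕ i)) (≤-pred (toℕ<n j)))
    returns : iter f (toℕ i) (iter f (suc p) h) ≡ iter f (toℕ i) h
    returns = begin
      iter f (toℕ i) (iter f (suc p) h)  ≡⟨ sym (iter-+ f (toℕ i) (suc p) h) ⟩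
      iter f (toℕ i + suc p) h           ≡⟨ cong (λ z → iter f (toℕ i + z) h) suc-p ⟩
      iter f (toℕ i + (toℕ j ∸ toℕ i)) h ≡⟨ cong (λ z → iter f z h) (m+[n∸m]≡n (<⇒≤ i<j)) ⟩
      iter f (toℕ j) h                   ≡⟨ sym e ⟩
      iter f (toℕ i) h                   ∎

  iter-period : ∀ p h → iter f (suc p) h ≡ h → ∀ k → iter f (k * suc p) h ≡ h
  iter-period p h e zero    = refl
  iter-period p h e (suc k) =
    trans (iter-+ f (suc p) (k * suc p) h) (trans (cong (iter f (suc p)) (iter-period p h e k)) e)

  orbit-sym : ∀ {h j} → InOrbit f h j → InOrbit f j h
  orbit-sym {h} (i , refl) with period h
  ... | p , _ , e = i * p , (begin
      iter f (i * p) (iter f i h) ≡⟨ sym (iter-+ f (i * p) i h) ⟩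
      iter f (i * p + i) h        ≡⟨ cong (λ z → iter f z h) (trans (+-comm (i * p) i) (sym (*-suc i p))) ⟩
      iter f (i * suc p) h        ≡⟨ iter-period p h e i ⟩
      h                           ∎)
    where open ≡-Reasoning

  orbit-bounded : ∀ {h j} → InOrbit f h j → Σ ℕ λ i → i < n × iter f i h ≡ j
  orbit-bounded {h} (i , refl) with period h
  ... | p , p<n , e = i % suc p , <-≤-trans (m%n<n i (suc p)) p<n , (begin
      iter f (i % suc p) h                                ≡⟨ cong (iter f (i % suc p)) (sym (iter-period p h e (i / suc p))) ⟩
      iter f (i % suc p) (iter f ((i / suc p) * suc p) h) ≡⟨ sym (iter-+ f (i % suc p) _ h) ⟩
      iter f (i % suc p + (i / suc p) * suc p) h          ≡⟨ cong (λ z → iter f z h) (sym (m≡m%n+[m/n]*n i (suc p))) ⟩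
      iter f i h                                          ∎)
    where open ≡-Reasoning

  member⇒inOrbit : ∀ {h j} → j ∈ orbitList f h → InOrbit f h j
  member⇒inOrbit m with ∈-map⁻ (λ i → iter f i _) m
  ... | i , _ , e = i , sym e

  inOrbit⇒member : ∀ {h j} → InOrbit f h j → j ∈ orbitList f h
  inOrbit⇒member o with orbit-bounded o
  ... | i , i<n , refl = ∈-map⁺ (λ i → iter f i _) (∈-upTo⁺ i<n)

  open DecMembership (_≟_ {n}) using (_∈?_)

  inOrbit? : ∀ h → Decidable (InOrbit f h)
  inOrbit? h j = map′ member⇒inOrbit inOrbit⇒member (j ∈? orbitList f h)

  all⇒isLeast : ∀ {h} → All (λ j → toℕ h ≤ toℕ j) (orbitList f h) → IsLeast f h
  all⇒isLeast all j o = All.lookup all (inOrbit⇒member o)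

  isLeast⇒all : ∀ {h} → IsLeast f h → All (λ j → toℕ h ≤ toℕ j) (orbitList f h)
  isLeast⇒all least = All.tabulate (λ m → least _ (member⇒inOrbit m))

  isLeast? : Decidable (IsLeast f)
  isLeast? h = map′ all⇒isLeast isLeast⇒all (all? (λ j → toℕ h ≤? toℕ j) (orbitList f h))

  orbitSize-count : ∀ h → orbitSize f h ≡ count (inOrbit? h)
  orbitSize-count h = trans (length-filter-tabulate (λ j → j ∈? orbitList f h) id)
    (count-cong _ (inOrbit? h) (λ _ → member⇒inOrbit) (λ _ → inOrbit⇒member))

  numCycles-count : numCycles f ≡ count isLeast?
  numCycles-count = trans (length-filter-tabulate (λ h → all? (λ j → toℕ h ≤? toℕ j) (orbitList f h)) id)
    (count-cong _ isLeast? (λ _ → all⇒isLeast) (λ _ → isLeast⇒all))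

  one-least-per-orbit : ∀ p → count (isLeast? ∩? inOrbit? p) ≡ 1
  one-least-per-orbit p with least-witness (inOrbit? p) (orbit-refl f p)
  ... | m , p→m , m-least = count-unique (isLeast? ∩? inOrbit? p) (m-isLeast , p→m) unique
    where
    m-isLeast : IsLeast f m
    m-isLeast j m→j = m-least j (orbit-trans f p→m m→j)
    unique : ∀ i → IsLeast f i × InOrbit f p i → i ≡ m
    unique i (i-least , p→i) = toℕ-injective (≤-antisym
      (i-least m (orbit-trans f (orbit-sym p→i) p→m)) (m-least i p→i))

  numCycles-split : ∀ p → numCycles f ≡ suc (count (isLeast? ∩? ∁? (inOrbit? p)))
  numCycles-split p = begin
    numCycles f                                ≡⟨ numCycles-count ⟩
    count isLeast?                             ≡⟨ count-split isLeast? (inOrbit? p) ⟩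
    count (isLeast? ∩? inOrbit? p) + others    ≡⟨ cong (_+ others) (one-least-per-orbit p) ⟩
    suc others                                 ∎
    where
    open ≡-Reasoning
    others : ℕ
    others = count (isLeast? ∩? ∁? (inOrbit? p))

permutation-injective : ∀ {m n} (π : Permutation m n) → Injective _≡_ _≡_ (π ⟨$⟩ʳ_)
permutation-injective π eq = trans (sym (inverseˡ π)) (trans (cong (π ⟨$⟩ˡ_) eq) (inverseˡ π))

involution-injective : ∀ {m} {g : Fin m → Fin m} → (∀ z → g (g z) ≡ z) → Injective _≡_ _≡_ g
involution-injective {g = g} invol {u} {v} eq = trans (sym (invol u)) (trans (cong g eq) (invol v))

injective⇒surjective : ∀ {n} (f : Fin n → Fin n) → Injective _≡_ _≡_ f → ∀ z → Σ (Fin n) λ i → f i ≡ z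
injective⇒surjective {suc m} f f-inj z with any? (λ i → f i ≟ z)
... | yes hit = hit
... | no miss with pigeonhole (n<1+n m) (λ i → punchOut {i = z} {j = f i} (λ e → miss (i , sym e)))
... | i , j , i<j , e = ⊥-elim (<-irrefl (cong toℕ (f-inj (punchOut-injective {i = z} _ _ e))) i<j)

injection⇒permutation : ∀ {n} (f : Fin n → Fin n) → Injective _≡_ _≡_ f → Permutation′ n
injection⇒permutation {n} f f-inj =
  permutation f (proj₁ ∘ surj) (proj₂ ∘ surj) (λ i → f-inj (proj₂ (surj (f i))))
  where
  surj : ∀ z → Σ (Fin n) λ i → f i ≡ z
  surj = injective⇒surjective f f-inj

-- Fin (2 + d) as two distinguished elements x, y and the order-preserving
-- image of Fin d under e = punchIn x ∘ punchIn y₀.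

module Complement {d : ℕ} (x : Fin (suc (suc d))) (y₀ : Fin (suc d)) where

  y : Fin (suc (suc d))
  y = punchIn x y₀

  e : Fin d → Fin (suc (suc d))
  e h = punchIn x (punchIn y₀ h)

  x≢y : x ≢ y
  x≢y eq = punchInᵢ≢i x y₀ (sym eq)

  e≢x : ∀ h → e h ≢ x
  e≢x h = punchInᵢ≢i x _

  e≢y : ∀ h → e h ≢ y
  e≢y h eq = punchInᵢ≢i y₀ h (punchIn-injective x _ _ eq)

  e-injective : Injective _≡_ _≡_ e
  e-injective eq = punchIn-injective y₀ _ _ (punchIn-injective x _ _ eq)

  e-monotone : ∀ {a b} → toℕ a ≤ toℕ b → toℕ (e a) ≤ toℕ (e b)
  e-monotone le = punchIn-mono-≤ x _ _ (punchIn-mono-≤ y₀ _ _ le)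

  e-reflects-≤ : ∀ {a b} → toℕ (e a) ≤ toℕ (e b) → toℕ a ≤ toℕ b
  e-reflects-≤ le = punchIn-cancel-≤ y₀ _ _ (punchIn-cancel-≤ x _ _ le)

  view : ∀ z → z ≡ x ⊎ z ≡ y ⊎ Σ (Fin d) λ h → e h ≡ z
  view z with z ≟ x
  ... | yes z≡x = inj₁ z≡x
  ... | no z≢x with punchOut (z≢x ∘ sym) ≟ y₀
  ... | yes eq = inj₂ (inj₁ (trans (sym (punchIn-punchOut (z≢x ∘ sym))) (cong (punchIn x) eq)))
  ... | no ne  = inj₂ (inj₂ (punchOut (ne ∘ sym) ,
                   trans (cong (punchIn x) (punchIn-punchOut (ne ∘ sym))) (punchIn-punchOut (z≢x ∘ sym))))

  elim : ∀ (P : Fin (suc (suc d)) → Set) → P x → P y → (∀ h → P (e h)) → ∀ z → P z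
  elim P px py pe z with view z
  ... | inj₁ refl              = px
  ... | inj₂ (inj₁ refl)       = py
  ... | inj₂ (inj₂ (h , refl)) = pe h

  preimage : ∀ z → z ≢ x → z ≢ y → Σ (Fin d) λ h → e h ≡ z
  preimage z z≢x z≢y with view z
  ... | inj₁ p        = ⊥-elim (z≢x p)
  ... | inj₂ (inj₁ p) = ⊥-elim (z≢y p)
  ... | inj₂ (inj₂ q) = q

  count-complement : ∀ {P : Fin (suc (suc d)) → Set} (P? : Decidable P) →
    count P? ≡ ind (P? x) + ind (P? y) + count (λ h → P? (e h))
  count-complement P? =
    trans (count-punchIn P? x) (trans (cong (ind (P? x) +_) (count-punchIn (λ i → P? (punchIn x i)) y₀))
      (sym (+-assoc (ind (P? x)) _ _)))

  cases : ∀ {A : Set} → A → A → (Fin d → A) → Fin (suc (suc d)) → A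
  cases ax ay ae z with view z
  ... | inj₁ _              = ax
  ... | inj₂ (inj₁ _)       = ay
  ... | inj₂ (inj₂ (h , _)) = ae h

  cases-x : ∀ {A : Set} (ax ay : A) ae → cases ax ay ae x ≡ ax
  cases-x ax ay ae with view x
  ... | inj₁ _              = refl
  ... | inj₂ (inj₁ p)       = ⊥-elim (x≢y p)
  ... | inj₂ (inj₂ (h , p)) = ⊥-elim (e≢x h p)

  cases-y : ∀ {A : Set} (ax ay : A) ae → cases ax ay ae y ≡ ay
  cases-y ax ay ae with view y
  ... | inj₁ p              = ⊥-elim (x≢y (sym p))
  ... | inj₂ (inj₁ _)       = refl
  ... | inj₂ (inj₂ (h , p)) = ⊥-elim (e≢y h p)

  cases-e : ∀ {A : Set} (ax ay : A) ae h → cases ax ay ae (e h) ≡ ae h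
  cases-e ax ay ae h with view (e h)
  ... | inj₁ p               = ⊥-elim (e≢x h p)
  ... | inj₂ (inj₁ p)        = ⊥-elim (e≢y h p)
  ... | inj₂ (inj₂ (h' , p)) = cong ae (e-injective p)

-- Let f act on Fin d and f' on Fin (2 + d) such that f'
-- copies f along e except at the dart p:  f' (e h) ≡ e (f h) for h ≢ p.
-- Then the orbits of f avoiding p are copied verbatim by f', and the orbit of
-- p is copied into the orbit of f' through a new dart c (which may also
-- contain x and y).

module OrbitTransfer {d : ℕ} (x : Fin (suc (suc d))) (y₀ : Fin (suc d))
  (f : Fin d → Fin d) (f' : Fin (suc (suc d)) → Fin (suc (suc d)))
  (f-inj : Injective _≡_ _≡_ f) (f'-inj : Injective _≡_ _≡_ f')
  (p : Fin d) (agree : ∀ h → h ≢ p → f' (Complement.e x y₀ h) ≡ Complement.e x y₀ (f h)) where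

  open Complement x y₀
  module O  = Orbits f f-inj
  module O' = Orbits f' f'-inj

  copy-iter : ∀ {h} → ¬ InOrbit f p h → ∀ i → iter f' i (e h) ≡ e (iter f i h)
  copy-iter ¬p→h zero    = refl
  copy-iter ¬p→h (suc i) = trans (cong f' (copy-iter ¬p→h i)) (agree _ (λ eq → ¬p→h (O.orbit-sym (i , eq))))

  copy-orbit : ∀ {h j} → ¬ InOrbit f p h → InOrbit f h j → InOrbit f' (e h) (e j)
  copy-orbit ¬p→h (i , refl) = i , copy-iter ¬p→h i

  copied-orbit : ∀ {h z} → ¬ InOrbit f p h → InOrbit f' (e h) z → Σ (Fin d) λ j → e j ≡ z × InOrbit f h j
  copied-orbit {h} ¬p→h (i , refl) = iter f i h , sym (copy-iter ¬p→h i) , i , refl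

  reaches-p : ∀ i h → iter f i h ≡ p → InOrbit f' (e h) (e p)
  reaches-p zero    h eq = 0 , cong e eq
  reaches-p (suc i) h eq with h ≟ p
  ... | yes refl = orbit-refl f' (e p)
  ... | no h≢p   = orbit-trans f' (1 , agree h h≢p) (reaches-p i (f h) (trans (iter-shift f i h) eq))

  successor-reaches-p : InOrbit f' (e (f p)) (e p)
  successor-reaches-p with O.orbit-sym (orbit-step f p)
  ... | i , eq = reaches-p i (f p) eq

  copy-least : ∀ {h} → ¬ InOrbit f p h → IsLeast f h → IsLeast f' (e h)
  copy-least ¬p→h least z h→z with copied-orbit ¬p→h h→z
  ... | j , refl , h→j = e-monotone (least j h→j)

  copied-least : ∀ {h} → ¬ InOrbit f p h → IsLeast f' (e h) → IsLeast f h
  copied-least ¬p→h least j h→j = e-reflects-≤ (least (e j) (copy-orbit ¬p→h h→j))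

  orbitSize-transfer : ∀ {z w} → (∀ h → InOrbit f' z (e h) → InOrbit f w h) →
                                  (∀ h → InOrbit f w h → InOrbit f' z (e h)) →
    orbitSize f' z ≡ ind (O'.inOrbit? z x) + ind (O'.inOrbit? z y) + orbitSize f w
  orbitSize-transfer {z} {w} to from = begin
    orbitSize f' z                                         ≡⟨ O'.orbitSize-count z ⟩
    count (O'.inOrbit? z)                                  ≡⟨ count-complement (O'.inOrbit? z) ⟩
    extra + count (λ h → O'.inOrbit? z (e h))              ≡⟨ cong (extra +_) (count-cong _ _ to from) ⟩
    extra + count (O.inOrbit? w)                           ≡⟨ cong (extra +_) (sym (O.orbitSize-count w)) ⟩
    extra + orbitSize f w                                  ∎
    where
    open ≡-Reasoning
    extra : ℕ
    extra = ind (O'.inOrbit? z x) + ind (O'.inOrbit? z y)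

  orbitSize-copied : ∀ {h} → ¬ InOrbit f p h → orbitSize f' (e h) ≡ orbitSize f h
  orbitSize-copied {h} ¬p→h =
    trans (orbitSize-transfer to (λ _ → copy-orbit ¬p→h))
          (cong₂ (λ a b → a + b + orbitSize f h) (ind-no (O'.inOrbit? (e h) x) (new e≢x))
                                                  (ind-no (O'.inOrbit? (e h) y) (new e≢y)))
    where
    to : ∀ j → InOrbit f' (e h) (e j) → InOrbit f h j
    to j h→j with copied-orbit ¬p→h h→j
    ... | j' , eq , h→j' = subst (InOrbit f h) (e-injective eq) h→j'
    new : ∀ {z} → (∀ j → e j ≢ z) → ¬ InOrbit f' (e h) z
    new e≢z h→z = e≢z _ (proj₁ (proj₂ (copied-orbit ¬p→h h→z)))

  module Special (c : Fin (suc (suc d))) (e≢c : ∀ h → e h ≢ c) (c→p : InOrbit f' c (e p)) where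

    special⇐ : ∀ {h} → InOrbit f p h → InOrbit f' c (e h)
    special⇐ {h} p→h with O.orbit-sym p→h
    ... | i , h→p = orbit-trans f' c→p (O'.orbit-sym (reaches-p i h h→p))

    special⇒ : ∀ {h} → InOrbit f' c (e h) → InOrbit f p h
    special⇒ {h} c→h with O.inOrbit? p h
    ... | yes p→h  = p→h
    ... | no ¬p→h  = ⊥-elim (e≢c _ (proj₁ (proj₂ (copied-orbit ¬p→h (O'.orbit-sym c→h)))))

    orbitSize-special : orbitSize f' c ≡ ind (O'.inOrbit? c x) + ind (O'.inOrbit? c y) + orbitSize f p
    orbitSize-special = orbitSize-transfer (λ _ → special⇒) (λ _ → special⇐)

    newCycle? : Decidable (λ z → IsLeast f' z × ¬ InOrbit f' c z)
    newCycle? = O'.isLeast? ∩? ∁? (O'.inOrbit? c)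

    numCycles-transfer : numCycles f' ≡ ind (newCycle? x) + ind (newCycle? y) + numCycles f
    numCycles-transfer = begin
      numCycles f'                                   ≡⟨ O'.numCycles-split c ⟩
      suc (count newCycle?)                          ≡⟨ cong suc (count-complement newCycle?) ⟩
      suc (extra + count (λ h → newCycle? (e h)))    ≡⟨ cong (λ n → suc (extra + n)) (count-cong _ _ to from) ⟩
      suc (extra + count old?)                       ≡⟨ sym (+-suc extra (count old?)) ⟩
      extra + suc (count old?)                       ≡⟨ cong (extra +_) (sym (O.numCycles-split p)) ⟩
      extra + numCycles f                            ∎
      where
      open ≡-Reasoning
      extra : ℕ
      extra = ind (newCycle? x) + ind (newCycle? y)
      old? : Decidable (λ h → IsLeast f h × ¬ InOrbit f p h)
      old? = O.isLeast? ∩? ∁? (O.inOrbit? p)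
      to : ∀ h → IsLeast f' (e h) × ¬ InOrbit f' c (e h) → IsLeast f h × ¬ InOrbit f p h
      to h (least , ¬c→h) = copied-least (¬c→h ∘ special⇐) least , ¬c→h ∘ special⇐
      from : ∀ h → IsLeast f h × ¬ InOrbit f p h → IsLeast f' (e h) × ¬ InOrbit f' c (e h)
      from h (least , ¬p→h) = copy-least ¬p→h least , ¬p→h ∘ special⇒

-- The dart structure (σ', α') on Fin (2 + d)
-- with root dart x arises from (σ, α) on Fin d with root dart r by adding an
-- edge {x, y}: x alone forms a new vertex of degree one, and y is inserted
-- into the rotation around the co-root vertex of r right after α r.  The
-- root face is extended by the two sides of the new edge; every other face
-- and every vertex other than the co-root is unchanged.

record RootEdgeInsertion {d : ℕ} (σ α : Fin d → Fin d) (r : Fin d)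
                         (σ' α' : Fin (suc (suc d)) → Fin (suc (suc d))) (x : Fin (suc (suc d))) : Set where
  field
    y₀ : Fin (suc d)
  open Complement x y₀ public
  field
    α'-x      : α' x ≡ y
    α'-e      : ∀ h → α' (e h) ≡ e (α h)
    σ'-x      : σ' x ≡ x
    σ'-y      : σ' y ≡ e (σ (α r))
    σ'-coroot : σ' (e (α r)) ≡ y
    σ'-e      : ∀ h → h ≢ α r → σ' (e h) ≡ e (σ h)

module InsertionProperties {d : ℕ} {σ α : Fin d → Fin d} {r : Fin d}
  {σ' α' : Fin (suc (suc d)) → Fin (suc (suc d))} {x : Fin (suc (suc d))}
  (I : RootEdgeInsertion σ α r σ' α' x)
  (σ-inj : Injective _≡_ _≡_ σ) (α-invol : ∀ h → α (α h) ≡ h)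
  (σ'-inj : Injective _≡_ _≡_ σ') (α'-invol : ∀ z → α' (α' z) ≡ z) where

  open RootEdgeInsertion I

  φ : Fin d → Fin d
  φ h = σ (α h)

  φ' : Fin (suc (suc d)) → Fin (suc (suc d))
  φ' z = σ' (α' z)

  φ-inj : Injective _≡_ _≡_ φ
  φ-inj = involution-injective α-invol ∘ σ-inj

  φ'-inj : Injective _≡_ _≡_ φ'
  φ'-inj = involution-injective α'-invol ∘ σ'-inj

  α'-y : α' y ≡ x
  α'-y = trans (cong α' (sym α'-x)) (α'-invol x)

  φ'-x : φ' x ≡ e (φ r)
  φ'-x = trans (cong σ' α'-x) σ'-y

  φ'-root : φ' (e r) ≡ y
  φ'-root = trans (cong σ' (α'-e r)) σ'-coroot

  φ'-e : ∀ h → h ≢ r → φ' (e h) ≡ e (φ h)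
  φ'-e h h≢r = trans (cong σ' (α'-e h)) (σ'-e (α h) (λ eq → h≢r (involution-injective α-invol eq)))

  module Vertices = OrbitTransfer x y₀ σ σ' σ-inj σ'-inj (α r) σ'-e
  module Faces    = OrbitTransfer x y₀ φ φ' φ-inj φ'-inj r φ'-e

  -- The co-root vertex gains the dart y; the root face gains x and y.
  module CoRootVertex = Vertices.Special y e≢y (orbit-trans σ' (1 , σ'-y) Vertices.successor-reaches-p)
  module RootFace     = Faces.Special x e≢x (orbit-trans φ' (1 , φ'-x) Faces.successor-reaches-p)

  x-isolated : ∀ {z} → InOrbit σ' x z → z ≡ x
  x-isolated = fixed-orbit σ' σ'-x

  root-face-y : InOrbit φ' x y
  root-face-y = orbit-trans φ' (RootFace.special⇐ (orbit-refl φ r)) (1 , φ'-root)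

  numCycles-σ' : numCycles σ' ≡ suc (numCycles σ)
  numCycles-σ' = trans CoRootVertex.numCycles-transfer
    (cong₂ (λ a b → a + b + numCycles σ)
      (ind-yes (CoRootVertex.newCycle? x) ((λ z x→z → ≤-reflexive (cong toℕ (sym (x-isolated x→z)))) ,
                                           (λ y→x → x≢y (sym (x-isolated (Vertices.O'.orbit-sym y→x))))))
      (ind-no (CoRootVertex.newCycle? y) (λ new → proj₂ new (orbit-refl σ' y))))

  numCycles-φ' : numCycles φ' ≡ numCycles φ
  numCycles-φ' = trans RootFace.numCycles-transfer
    (cong₂ (λ a b → a + b + numCycles φ)
      (ind-no (RootFace.newCycle? x) (λ new → proj₂ new (orbit-refl φ' x)))
      (ind-no (RootFace.newCycle? y) (λ new → proj₂ new root-face-y)))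

  euler : 2 * (numCycles σ' + numCycles φ') ≡ 2 + 2 * (numCycles σ + numCycles φ)
  euler = trans (cong₂ (λ v f → 2 * (v + f)) numCycles-σ' numCycles-φ') (*-suc 2 (numCycles σ + numCycles φ))

  root-face-size : orbitSize φ' x ≡ 2 + orbitSize φ r
  root-face-size = trans RootFace.orbitSize-special
    (cong₂ (λ a b → a + b + orbitSize φ r)
      (ind-yes (Faces.O'.inOrbit? x x) (orbit-refl φ' x))
      (ind-yes (Faces.O'.inOrbit? x y) root-face-y))

  root-vertex-degree : orbitSize σ' x ≡ 1
  root-vertex-degree = trans (Vertices.O'.orbitSize-count x)
    (count-unique (Vertices.O'.inOrbit? x) (orbit-refl σ' x) (λ _ → x-isolated))

  reach-orbit : ∀ {z w} → Reach σ' α' x z → InOrbit σ' z w → Reach σ' α' x w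
  reach-orbit reach (i , refl) = reach-iter i
    where
    reach-iter : ∀ i → Reach σ' α' x (iter σ' i _)
    reach-iter zero    = reach
    reach-iter (suc i) = vias (reach-iter i)

  reach-e : ∀ {h} → Reach σ α r h → Reach σ' α' x (e h)
  reach-e base = subst (Reach σ' α' x) (trans (α'-e (α r)) (cong e (α-invol r)))
    (viaa (reach-orbit (subst (Reach σ' α' x) σ'-y (vias (subst (Reach σ' α' x) α'-x (viaa base))))
                       Vertices.successor-reaches-p))
  reach-e (vias {h} reach) with h ≟ α r
  ... | yes refl = subst (Reach σ' α' x) σ'-y (vias (subst (Reach σ' α' x) σ'-coroot (vias (reach-e reach))))
  ... | no h≢αr  = subst (Reach σ' α' x) (σ'-e h h≢αr) (vias (reach-e reach))
  reach-e (viaa {h} reach) = subst (Reach σ' α' x) (α'-e h) (viaa (reach-e reach))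

  reach-back : ∀ {z} → Reach σ' α' x z → z ≡ x ⊎ z ≡ y ⊎ Σ (Fin d) λ h → e h ≡ z × Reach σ α r h
  reach-back base = inj₁ refl
  reach-back (vias reach) with reach-back reach
  ... | inj₁ refl                      = inj₁ σ'-x
  ... | inj₂ (inj₁ refl)               = inj₂ (inj₂ (σ (α r) , sym σ'-y , vias (viaa base)))
  ... | inj₂ (inj₂ (h , refl , reach-h)) with h ≟ α r
  ... | yes refl = inj₂ (inj₁ σ'-coroot)
  ... | no h≢αr  = inj₂ (inj₂ (σ h , sym (σ'-e h h≢αr) , vias reach-h))
  reach-back (viaa reach) with reach-back reach
  ... | inj₁ refl                      = inj₂ (inj₁ α'-x)
  ... | inj₂ (inj₁ refl)               = inj₁ α'-y
  ... | inj₂ (inj₂ (h , refl , reach-h)) = inj₂ (inj₂ (α h , sym (α'-e h) , viaa reach-h))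

  reach-e⁻¹ : ∀ {h} → Reach σ' α' x (e h) → Reach σ α r h
  reach-e⁻¹ {h} reach with reach-back reach
  ... | inj₁ eq                      = ⊥-elim (e≢x h eq)
  ... | inj₂ (inj₁ eq)               = ⊥-elim (e≢y h eq)
  ... | inj₂ (inj₂ (h' , eq , reach-h')) = subst (Reach σ α r) (e-injective eq) reach-h'

record PendantRootEdge {d : ℕ} (S : LMap d) (B : LMap (suc (suc d))) : Set where
  field
    insertion : RootEdgeInsertion (LMap.σ S ⟨$⟩ʳ_) (LMap.α S) (LMap.r S) (LMap.σ B ⟨$⟩ʳ_) (LMap.α B) (LMap.r B)
  open RootEdgeInsertion insertion public
  field
    lab-e : ∀ h → LMap.lab B (e h) ≡ LMap.lab S h

  α-y : LMap.α B y ≡ LMap.r B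
  α-y = trans (cong (LMap.α B) (sym α'-x)) (LMap.α-invol B (LMap.r B))

  lab-y : LMap.lab B y ≡ 1ℤ
  lab-y = trans (cong (LMap.lab B) (sym α'-x)) (proj₂ (LMap.lab-root B))

ZeroOneEdge : ℤ → ℤ → Set
ZeroOneEdge u v = ((u ≡ 0ℤ) × (v ≡ 1ℤ)) ⊎ ((u ≡ 1ℤ) × (v ≡ 0ℤ))

φ-injective : ∀ {d} (M : LMap d) → Injective _≡_ _≡_ (LMap.φ M)
φ-injective M = involution-injective (LMap.α-invol M) ∘ permutation-injective (LMap.σ M)

RootDegreeOne : ∀ {d} → LMap d → Set
RootDegreeOne M = LMap.σ M ⟨$⟩ʳ LMap.r M ≡ LMap.r M

CoRootDegreeOne : ∀ {d} → LMap d → Set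
CoRootDegreeOne M = LMap.σ M ⟨$⟩ʳ LMap.α M (LMap.r M) ≡ LMap.α M (LMap.r M)

record Isomorphism {d d' : ℕ} (M : LMap d) (N : LMap d') : Set where
  field
    π     : Permutation d d'
    π-σ   : ∀ h → π ⟨$⟩ʳ (LMap.σ M ⟨$⟩ʳ h) ≡ LMap.σ N ⟨$⟩ʳ (π ⟨$⟩ʳ h)
    π-α   : ∀ h → π ⟨$⟩ʳ (LMap.α M h) ≡ LMap.α N (π ⟨$⟩ʳ h)
    π-r   : π ⟨$⟩ʳ LMap.r M ≡ LMap.r N
    π-lab : ∀ h → LMap.lab N (π ⟨$⟩ʳ h) ≡ LMap.lab M h

  isomorphic : nonatomic d M ≅ nonatomic d' N
  isomorphic = map≅ π π-σ π-α π-r π-lab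

isomorphism : ∀ {d d'} {M : LMap d} {N : LMap d'} → nonatomic d M ≅ nonatomic d' N → Isomorphism M N
isomorphism (map≅ π π-σ π-α π-r π-lab) = record { π = π ; π-σ = π-σ ; π-α = π-α ; π-r = π-r ; π-lab = π-lab }

identity : ∀ {d} (M : LMap d) → Isomorphism M M
identity M = record
  { π = Data.Fin.Permutation.id ; π-σ = λ _ → refl ; π-α = λ _ → refl ; π-r = refl ; π-lab = λ _ → refl }

module _ {d d₂ : ℕ} {S : LMap d} {B : LMap (suc (suc d))} {S₂ : LMap d₂} {B₂ : LMap (suc (suc d₂))}
         (R : PendantRootEdge S B) (R₂ : PendantRootEdge S₂ B₂) where

  private
    module R  = PendantRootEdge R
    module R₂ = PendantRootEdge R₂
    σS : Fin d → Fin d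
    σS = LMap.σ S ⟨$⟩ʳ_
    σS₂ : Fin d₂ → Fin d₂
    σS₂ = LMap.σ S₂ ⟨$⟩ʳ_
    σB : Fin (suc (suc d)) → Fin (suc (suc d))
    σB = LMap.σ B ⟨$⟩ʳ_
    σB₂ : Fin (suc (suc d₂)) → Fin (suc (suc d₂))
    σB₂ = LMap.σ B₂ ⟨$⟩ʳ_
    a : Fin d
    a = LMap.α S (LMap.r S)
    a₂ : Fin d₂
    a₂ = LMap.α S₂ (LMap.r S₂)
    x : Fin (suc (suc d))
    x = LMap.r B
    x₂ : Fin (suc (suc d₂))
    x₂ = LMap.r B₂

  module Extension (iso : Isomorphism S S₂) where
    open Isomorphism iso renaming (π to f; π-σ to f-σ; π-α to f-α; π-r to f-r; π-lab to f-lab)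
    f-a : f ⟨$⟩ʳ a ≡ a₂
    f-a = trans (f-α (LMap.r S)) (cong (LMap.α S₂) f-r)
    F : Fin (suc (suc d)) → Fin (suc (suc d₂))
    F = R.cases x₂ R₂.y (λ h → R₂.e (f ⟨$⟩ʳ h))
    G : Fin (suc (suc d₂)) → Fin (suc (suc d))
    G = R₂.cases x R.y (λ h → R.e (f ⟨$⟩ˡ h))
    F-x : F x ≡ x₂
    F-x = R.cases-x _ _ _
    F-y : F R.y ≡ R₂.y
    F-y = R.cases-y _ _ _
    F-e : ∀ h → F (R.e h) ≡ R₂.e (f ⟨$⟩ʳ h)
    F-e = R.cases-e _ _ _
    F∘G : ∀ z → F (G z) ≡ z
    F∘G = R₂.elim (λ z → F (G z) ≡ z) (trans (cong F (R₂.cases-x _ _ _)) F-x) (trans (cong F (R₂.cases-y _ _ _)) F-y)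
      λ h → trans (cong F (R₂.cases-e _ _ _ h)) (trans (F-e _) (cong R₂.e (inverseʳ f)))
    G∘F : ∀ z → G (F z) ≡ z
    G∘F = R.elim (λ z → G (F z) ≡ z) (trans (cong G F-x) (R₂.cases-x _ _ _)) (trans (cong G F-y) (R₂.cases-y _ _ _))
      λ h → trans (cong G (F-e h)) (trans (R₂.cases-e _ _ _ _) (cong R.e (inverseˡ f)))
    F-σe : ∀ h → F (σB (R.e h)) ≡ σB₂ (F (R.e h))
    F-σe h with h ≟ a
    ... | yes refl = trans (cong F R.σ'-coroot) (trans F-y
                       (sym (trans (cong σB₂ (F-e a)) (trans (cong (σB₂ ∘ R₂.e) f-a) R₂.σ'-coroot))))
    ... | no h≢a   = trans (cong F (R.σ'-e h h≢a)) (trans (F-e _) (trans (cong R₂.e (f-σ h))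
                       (sym (trans (cong σB₂ (F-e h))
                         (R₂.σ'-e (f ⟨$⟩ʳ h) (λ eq → h≢a (permutation-injective f (trans eq (sym f-a)))))))))
    F-σ : ∀ z → F (σB z) ≡ σB₂ (F z)
    F-σ = R.elim (λ z → F (σB z) ≡ σB₂ (F z))
      (trans (cong F R.σ'-x) (trans F-x (sym (trans (cong σB₂ F-x) R₂.σ'-x))))
      (trans (cong F R.σ'-y) (trans (F-e _) (trans (cong R₂.e (trans (f-σ a) (cong σS₂ f-a)))
                                                   (sym (trans (cong σB₂ F-y) R₂.σ'-y)))))
      F-σe
    F-α : ∀ z → F (LMap.α B z) ≡ LMap.α B₂ (F z)
    F-α = R.elim (λ z → F (LMap.α B z) ≡ LMap.α B₂ (F z))
      (trans (cong F R.α'-x) (trans F-y (sym (trans (cong (LMap.α B₂) F-x) R₂.α'-x))))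
      (trans (cong F R.α-y) (trans F-x (sym (trans (cong (LMap.α B₂) F-y) R₂.α-y))))
      λ h → trans (cong F (R.α'-e h)) (trans (F-e _) (trans (cong R₂.e (f-α h))
                                                         (sym (trans (cong (LMap.α B₂) (F-e h)) (R₂.α'-e _)))))
    F-lab : ∀ z → LMap.lab B₂ (F z) ≡ LMap.lab B z
    F-lab = R.elim (λ z → LMap.lab B₂ (F z) ≡ LMap.lab B z)
      (trans (cong (LMap.lab B₂) F-x) (trans (proj₁ (LMap.lab-root B₂)) (sym (proj₁ (LMap.lab-root B)))))
      (trans (cong (LMap.lab B₂) F-y) (trans R₂.lab-y (sym R.lab-y)))
      λ h → trans (cong (LMap.lab B₂) (F-e h)) (trans (R₂.lab-e _) (trans (f-lab h) (sym (R.lab-e h))))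

  extend-iso : Isomorphism S S₂ → Isomorphism B B₂
  extend-iso iso = record { π = permutation F G F∘G G∘F ; π-σ = F-σ ; π-α = F-α ; π-r = F-x ; π-lab = F-lab }
    where open Extension iso

  module Restriction (iso : Isomorphism B B₂) where
    open Isomorphism iso renaming (π to F; π-σ to F-σ; π-α to F-α; π-r to F-r; π-lab to F-lab)
    F-inj : Injective _≡_ _≡_ (F ⟨$⟩ʳ_)
    F-inj = permutation-injective F
    F-x : F ⟨$⟩ʳ x ≡ x₂
    F-x = F-r
    F-y : F ⟨$⟩ʳ R.y ≡ R₂.y
    F-y = trans (cong (F ⟨$⟩ʳ_) (sym R.α'-x)) (trans (F-α x) (trans (cong (LMap.α B₂) F-x) R₂.α'-x))
    f : Fin d → Fin d₂
    f h = proj₁ (R₂.preimage (F ⟨$⟩ʳ R.e h) (λ eq → R.e≢x h (F-inj (trans eq (sym F-x))))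
                                            (λ eq → R.e≢y h (F-inj (trans eq (sym F-y)))))
    e-f : ∀ h → R₂.e (f h) ≡ F ⟨$⟩ʳ R.e h
    e-f h = proj₂ (R₂.preimage _ _ _)
    g : Fin d₂ → Fin d
    g h = proj₁ (R.preimage (F ⟨$⟩ˡ R₂.e h)
                  (λ eq → R₂.e≢x h (trans (sym (inverseʳ F)) (trans (cong (F ⟨$⟩ʳ_) eq) F-x)))
                  (λ eq → R₂.e≢y h (trans (sym (inverseʳ F)) (trans (cong (F ⟨$⟩ʳ_) eq) F-y))))
    e-g : ∀ h → R.e (g h) ≡ F ⟨$⟩ˡ R₂.e h
    e-g h = proj₂ (R.preimage _ _ _)
    f∘g : ∀ h → f (g h) ≡ h
    f∘g h = R₂.e-injective (trans (e-f (g h)) (trans (cong (F ⟨$⟩ʳ_) (e-g h)) (inverseʳ F)))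
    g∘f : ∀ h → g (f h) ≡ h
    g∘f h = R.e-injective (trans (e-g (f h)) (trans (cong (F ⟨$⟩ˡ_) (e-f h)) (inverseˡ F)))
    f-inj : Injective _≡_ _≡_ f
    f-inj {u} {v} eq = R.e-injective (F-inj (trans (sym (e-f u)) (trans (cong R₂.e eq) (e-f v))))
    f-a : f a ≡ a₂
    f-a = R₂.e-injective (trans (e-f a) (permutation-injective (LMap.σ B₂)
            (trans (sym (F-σ (R.e a))) (trans (cong (F ⟨$⟩ʳ_) R.σ'-coroot) (trans F-y (sym R₂.σ'-coroot))))))
    f-σ : ∀ h → f (σS h) ≡ σS₂ (f h)
    f-σ h with h ≟ a
    ... | yes refl = R₂.e-injective (trans (e-f (σS a)) (trans (cong (F ⟨$⟩ʳ_) (sym R.σ'-y)) (trans (F-σ R.y)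
                       (trans (cong σB₂ F-y) (trans R₂.σ'-y (cong (R₂.e ∘ σS₂) (sym f-a)))))))
    ... | no h≢a   = R₂.e-injective (trans (e-f (σS h)) (trans (cong (F ⟨$⟩ʳ_) (sym (R.σ'-e h h≢a))) (trans (F-σ (R.e h))
                       (trans (cong σB₂ (sym (e-f h))) (R₂.σ'-e (f h) (λ eq → h≢a (f-inj (trans eq (sym f-a)))))))))
    f-α : ∀ h → f (LMap.α S h) ≡ LMap.α S₂ (f h)
    f-α h = R₂.e-injective (trans (e-f (LMap.α S h)) (trans (cong (F ⟨$⟩ʳ_) (sym (R.α'-e h))) (trans (F-α (R.e h))
              (trans (cong (LMap.α B₂) (sym (e-f h))) (R₂.α'-e (f h))))))
    f-r : f (LMap.r S) ≡ LMap.r S₂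
    f-r = trans (cong f (sym (LMap.α-invol S (LMap.r S))))
            (trans (f-α a) (trans (cong (LMap.α S₂) f-a) (LMap.α-invol S₂ (LMap.r S₂))))
    f-lab : ∀ h → LMap.lab S₂ (f h) ≡ LMap.lab S h
    f-lab h = trans (sym (R₂.lab-e (f h))) (trans (cong (LMap.lab B₂) (e-f h)) (trans (F-lab (R.e h)) (R.lab-e h)))

  restrict-iso : Isomorphism B B₂ → Isomorphism S S₂
  restrict-iso iso = record { π = permutation f g f∘g g∘f ; π-σ = f-σ ; π-α = f-α ; π-r = f-r ; π-lab = f-lab }
    where open Restriction iso

module PendantRootEdgeProperties {d : ℕ} {S : LMap d} {B : LMap (suc (suc d))} (R : PendantRootEdge S B) where

  open PendantRootEdge R
  open InsertionProperties insertion (permutation-injective (LMap.σ S)) (LMap.α-invol S)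
                                     (permutation-injective (LMap.σ B)) (LMap.α-invol B)

  inner-faces : innerFaces (nonatomic _ B) ≡ innerFaces (nonatomic d S)
  inner-faces = cong (_∸ 1) numCycles-φ'

  outer-degree : outerDegree (nonatomic _ B) ≡ 2 + outerDegree (nonatomic d S)
  outer-degree = root-face-size

  root-degree : rootDegree (nonatomic _ B) ≡ 1
  root-degree = root-vertex-degree

  patch⇒ : IsPatch (nonatomic d S) → IsPatch (nonatomic _ B)
  patch⇒ (quadrangles , alternating) = quadrangles' , alternating'
    where
    quadrangles' : ∀ z → ¬ InOrbit φ' (LMap.r B) z → orbitSize φ' z ≡ 4
    quadrangles' = elim _ (λ ¬x→x → ⊥-elim (¬x→x (orbit-refl φ' _))) (λ ¬x→y → ⊥-elim (¬x→y root-face-y))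
      λ h ¬x→h → let ¬r→h = ¬x→h ∘ RootFace.special⇐ in trans (Faces.orbitSize-copied ¬r→h) (quadrangles h ¬r→h)
    alternating' : ∀ z → InOrbit φ' (LMap.r B) z → ZeroOneEdge (LMap.lab B z) (LMap.lab B (LMap.α B z))
    alternating' = elim _ (λ _ → inj₁ (LMap.lab-root B))
      (λ _ → inj₂ (lab-y , trans (cong (LMap.lab B) α-y) (proj₁ (LMap.lab-root B))))
      λ h x→h → subst₂ ZeroOneEdge
                        (sym (lab-e h)) (sym (trans (cong (LMap.lab B) (α'-e h)) (lab-e _)))
                        (alternating h (RootFace.special⇒ x→h))

  cpatch⇒ : IsPatch (nonatomic d S) → IsCPatch (nonatomic _ B)
  cpatch⇒ patch = patch⇒ patch ,
    (λ h x→h → subst (λ z → LMap.lab B (LMap.α B z) ≡ 1ℤ) (sym (x-isolated x→h)) (proj₂ (LMap.lab-root B))) ,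
    (λ h x→h _ → x-isolated x→h)

  patch⇐ : IsPatch (nonatomic _ B) → IsPatch (nonatomic d S)
  patch⇐ (quadrangles' , alternating') = quadrangles , alternating
    where
    quadrangles : ∀ h → ¬ InOrbit φ (LMap.r S) h → orbitSize φ h ≡ 4
    quadrangles h ¬r→h = trans (sym (Faces.orbitSize-copied ¬r→h)) (quadrangles' (e h) (¬r→h ∘ RootFace.special⇒))
    alternating : ∀ h → InOrbit φ (LMap.r S) h → ZeroOneEdge (LMap.lab S h) (LMap.lab S (LMap.α S h))
    alternating h r→h = subst₂ ZeroOneEdge
                          (lab-e h) (trans (cong (LMap.lab B) (α'-e h)) (lab-e _))
                          (alternating' (e h) (RootFace.special⇐ r→h))

-- The new darts
-- are 0 (the new root, at a new vertex labelled 0) and 1 (its partner, at the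
-- old co-root vertex, labelled 1); the old dart h becomes 2 + h.  The rotation
-- is the lift of σ composed with the transposition that splices 1 in after
-- the co-root dart α r.

module AddRootEdge {d : ℕ} (M : LMap d) where

  open LMap M

  σ⁺ : Permutation′ (suc (suc d))
  σ⁺ = transpose (fs fz) (fs (fs (α r))) ∘ₚ lift₀ (lift₀ σ)

  σ⁺-coroot : σ⁺ ⟨$⟩ʳ fs (fs (α r)) ≡ fs fz
  σ⁺-coroot with α r ≟ α r
  ... | yes _  = refl
  ... | no ≢αr = ⊥-elim (≢αr refl)

  σ⁺-e : ∀ h → h ≢ α r → σ⁺ ⟨$⟩ʳ fs (fs h) ≡ fs (fs (σ ⟨$⟩ʳ h))
  σ⁺-e h h≢αr with h ≟ α r
  ... | yes h≡αr = ⊥-elim (h≢αr h≡αr)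
  ... | no _     = refl

  α⁺ : Fin (suc (suc d)) → Fin (suc (suc d))
  α⁺ fz           = fs fz
  α⁺ (fs fz)      = fz
  α⁺ (fs (fs h))  = fs (fs (α h))

  lab⁺ : Fin (suc (suc d)) → ℤ
  lab⁺ fz          = 0ℤ
  lab⁺ (fs fz)     = 1ℤ
  lab⁺ (fs (fs h)) = lab h

  α⁺-invol : ∀ z → α⁺ (α⁺ z) ≡ z
  α⁺-invol fz          = refl
  α⁺-invol (fs fz)     = refl
  α⁺-invol (fs (fs h)) = cong (fs ∘ fs) (α-invol h)

  α⁺-fpf : ∀ z → α⁺ z ≢ z
  α⁺-fpf fz          ()
  α⁺-fpf (fs fz)     ()
  α⁺-fpf (fs (fs h)) eq = α-fpf h (fs-injective (fs-injective eq))

  insertion : RootEdgeInsertion (σ ⟨$⟩ʳ_) α r (σ⁺ ⟨$⟩ʳ_) α⁺ fz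
  insertion = record
    { y₀ = fz ; α'-x = refl ; α'-e = λ _ → refl ; σ'-x = refl ; σ'-y = refl
    ; σ'-coroot = σ⁺-coroot ; σ'-e = σ⁺-e }

  open InsertionProperties insertion (permutation-injective σ) α-invol (permutation-injective σ⁺) α⁺-invol
    using (reach-e; euler)

  lab⁺-vertex : ∀ z → lab⁺ (σ⁺ ⟨$⟩ʳ z) ≡ lab⁺ z
  lab⁺-vertex fz          = refl
  lab⁺-vertex (fs fz)     = trans (lab-vertex (α r)) (proj₂ lab-root)
  lab⁺-vertex (fs (fs h)) with h ≟ α r
  ... | yes refl = sym (proj₂ lab-root)
  ... | no _     = lab-vertex h

  lab⁺-edge : ∀ z → (lab⁺ (α⁺ z) ≡ lab⁺ z +ℤ 1ℤ) ⊎ (lab⁺ (α⁺ z) ≡ lab⁺ z -ℤ 1ℤ)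
  lab⁺-edge fz          = inj₁ refl
  lab⁺-edge (fs fz)     = inj₂ refl
  lab⁺-edge (fs (fs h)) = lab-edge h

  connected⁺ : ∀ z → Reach (σ⁺ ⟨$⟩ʳ_) α⁺ fz z
  connected⁺ fz          = base
  connected⁺ (fs fz)     = viaa base
  connected⁺ (fs (fs h)) = reach-e (connected h)

  addRootEdge : LMap (suc (suc d))
  addRootEdge = record
    { σ = σ⁺ ; α = α⁺ ; α-invol = α⁺-invol ; α-fpf = α⁺-fpf ; r = fz ; lab = lab⁺
    ; connected = connected⁺ ; planar = trans euler (cong (2 +_) planar)
    ; lab-vertex = lab⁺-vertex ; lab-edge = lab⁺-edge ; lab-root = refl , refl }

  pendant : PendantRootEdge M addRootEdge
  pendant = record { insertion = insertion ; lab-e = λ _ → refl }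

-- The new
-- root is α a, where a is the dart preceding y around the co-root vertex:
-- the root face of B with the edge {x, y} removed is then the new root face.
-- Its root edge lies on the root face of B, so when B is a patch it goes
-- from label 0 to label 1.

module DeleteRootEdge {d : ℕ} (B : LMap (suc (suc d)))
  (σ-x : RootDegreeOne B) (σ-y≢y : ¬ CoRootDegreeOne B) where

  open LMap B using (lab-vertex; lab-edge; lab-root; connected) renaming
    (σ to σB; α to α'; r to x; lab to lab'; α-invol to α'-invol; α-fpf to α'-fpf)

  σ' : Fin (suc (suc d)) → Fin (suc (suc d))
  σ' = σB ⟨$⟩ʳ_

  σ'-inj : Injective _≡_ _≡_ σ'
  σ'-inj = permutation-injective σB

  x≢α'x : x ≢ α' x
  x≢α'x eq = α'-fpf x (sym eq)

  open Complement x (punchOut x≢α'x)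

  y≡α'x : y ≡ α' x
  y≡α'x = punchIn-punchOut x≢α'x

  σ'-y≢x : σ' y ≢ x
  σ'-y≢x eq = x≢y (sym (σ'-inj (trans eq (sym σ-x))))

  σ'-y≢y : σ' y ≢ y
  σ'-y≢y eq = σ-y≢y (trans (cong σ' (sym y≡α'x)) (trans eq y≡α'x))

  σ'-e≢x : ∀ h → σ' (e h) ≢ x
  σ'-e≢x h eq = e≢x h (σ'-inj (trans eq (sym σ-x)))

  -- The rotation skips y: the successor of the dart before y is σ' y.
  σ⁻ : Fin d → Fin d
  σ⁻ h with σ' (e h) ≟ y
  ... | yes _    = proj₁ (preimage (σ' y) σ'-y≢x σ'-y≢y)
  ... | no σeh≢y = proj₁ (preimage (σ' (e h)) (σ'-e≢x h) σeh≢y)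

  e-σ⁻-y : ∀ h → σ' (e h) ≡ y → e (σ⁻ h) ≡ σ' y
  e-σ⁻-y h σeh≡y with σ' (e h) ≟ y
  ... | yes _    = proj₂ (preimage (σ' y) σ'-y≢x σ'-y≢y)
  ... | no σeh≢y = ⊥-elim (σeh≢y σeh≡y)

  e-σ⁻ : ∀ h → σ' (e h) ≢ y → e (σ⁻ h) ≡ σ' (e h)
  e-σ⁻ h σeh≢y with σ' (e h) ≟ y
  ... | yes σeh≡y = ⊥-elim (σeh≢y σeh≡y)
  ... | no σeh≢y  = proj₂ (preimage (σ' (e h)) (σ'-e≢x h) σeh≢y)

  σ⁻-inj : Injective _≡_ _≡_ σ⁻
  σ⁻-inj {u} {v} eq = by-cases (σ' (e u) ≟ y) (σ' (e v) ≟ y)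
    where
    by-cases : Dec (σ' (e u) ≡ y) → Dec (σ' (e v) ≡ y) → u ≡ v
    by-cases (yes u→y) (yes v→y) = e-injective (σ'-inj (trans u→y (sym v→y)))
    by-cases (yes u→y) (no v↛y)  =
      ⊥-elim (e≢y v (σ'-inj (trans (sym (e-σ⁻ v v↛y)) (trans (cong e (sym eq)) (e-σ⁻-y u u→y)))))
    by-cases (no u↛y)  (yes v→y) =
      ⊥-elim (e≢y u (σ'-inj (trans (sym (e-σ⁻ u u↛y)) (trans (cong e eq) (e-σ⁻-y v v→y)))))
    by-cases (no u↛y)  (no v↛y)  = e-injective (σ'-inj (trans (sym (e-σ⁻ u u↛y)) (trans (cong e eq) (e-σ⁻ v v↛y))))

  α'-e≢x : ∀ h → α' (e h) ≢ x
  α'-e≢x h eq = e≢y h (trans (trans (sym (α'-invol (e h))) (cong α' eq)) (sym y≡α'x))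

  α'-e≢y : ∀ h → α' (e h) ≢ y
  α'-e≢y h eq = e≢x h (trans (sym (α'-invol (e h))) (trans (cong α' (trans eq y≡α'x)) (α'-invol x)))

  α⁻ : Fin d → Fin d
  α⁻ h = proj₁ (preimage (α' (e h)) (α'-e≢x h) (α'-e≢y h))

  e-α⁻ : ∀ h → e (α⁻ h) ≡ α' (e h)
  e-α⁻ h = proj₂ (preimage (α' (e h)) (α'-e≢x h) (α'-e≢y h))

  α⁻-invol : ∀ h → α⁻ (α⁻ h) ≡ h
  α⁻-invol h = e-injective (trans (e-α⁻ (α⁻ h)) (trans (cong α' (e-α⁻ h)) (α'-invol (e h))))

  α⁻-fpf : ∀ h → α⁻ h ≢ h
  α⁻-fpf h eq = α'-fpf (e h) (trans (sym (e-α⁻ h)) (cong e eq))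

  a-preimage : Σ (Fin d) λ h → e h ≡ σB ⟨$⟩ˡ y
  a-preimage = preimage (σB ⟨$⟩ˡ y)
    (λ eq → x≢y (trans (trans (sym σ-x) (cong σ' (sym eq))) (inverseʳ σB)))
    (λ eq → σ'-y≢y (trans (cong σ' (sym eq)) (inverseʳ σB)))

  a : Fin d
  a = proj₁ a-preimage

  σ'-a : σ' (e a) ≡ y
  σ'-a = trans (cong σ' (proj₂ a-preimage)) (inverseʳ σB)

  r⁻ : Fin d
  r⁻ = α⁻ a

  σ'-coroot : σ' (e (α⁻ r⁻)) ≡ y
  σ'-coroot = trans (cong (σ' ∘ e) (α⁻-invol a)) σ'-a

  insertion : RootEdgeInsertion σ⁻ α⁻ r⁻ σ' α' x
  insertion = record
    { y₀ = punchOut x≢α'x ; α'-x = sym y≡α'x ; α'-e = λ h → sym (e-α⁻ h) ; σ'-x = σ-x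
    ; σ'-y = sym (e-σ⁻-y (α⁻ r⁻) σ'-coroot) ; σ'-coroot = σ'-coroot
    ; σ'-e = λ h h≢ → sym (e-σ⁻ h (λ eq → h≢ (e-injective (σ'-inj (trans eq (sym σ'-coroot)))))) }

  open InsertionProperties insertion σ⁻-inj α⁻-invol σ'-inj α'-invol using (φ; euler; reach-e⁻¹; module RootFace)

  lab⁻ : Fin d → ℤ
  lab⁻ h = lab' (e h)

  lab⁻-vertex : ∀ h → lab⁻ (σ⁻ h) ≡ lab⁻ h
  lab⁻-vertex h = by-cases (σ' (e h) ≟ y)
    where
    by-cases : Dec (σ' (e h) ≡ y) → lab⁻ (σ⁻ h) ≡ lab⁻ h
    by-cases (yes σeh≡y) = trans (cong lab' (e-σ⁻-y h σeh≡y))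
                             (trans (lab-vertex y) (trans (cong lab' (sym σeh≡y)) (lab-vertex (e h))))
    by-cases (no σeh≢y)  = trans (cong lab' (e-σ⁻ h σeh≢y)) (lab-vertex (e h))

  lab⁻-edge : ∀ h → (lab⁻ (α⁻ h) ≡ lab⁻ h +ℤ 1ℤ) ⊎ (lab⁻ (α⁻ h) ≡ lab⁻ h -ℤ 1ℤ)
  lab⁻-edge h rewrite e-α⁻ h = lab-edge (e h)

  lab⁻-coroot : lab⁻ (α⁻ r⁻) ≡ 1ℤ
  lab⁻-coroot = trans (sym (lab-vertex (e (α⁻ r⁻))))
                  (trans (cong lab' σ'-coroot) (trans (cong lab' y≡α'x) (proj₂ lab-root)))

  lab⁻-root : IsPatch (nonatomic _ B) → lab⁻ r⁻ ≡ 0ℤ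
  lab⁻-root (_ , alternating) = root-side (alternating (e r⁻) (RootFace.special⇐ (orbit-refl φ r⁻)))
    where
    1≢0 : 1ℤ ≢ 0ℤ
    1≢0 ()
    root-side : ZeroOneEdge (lab' (e r⁻)) (lab' (α' (e r⁻))) → lab⁻ r⁻ ≡ 0ℤ
    root-side (inj₁ (lab≡0 , _))   = lab≡0
    root-side (inj₂ (_ , lab'≡0)) = ⊥-elim (1≢0 (trans (sym lab⁻-coroot) (trans (cong lab' (e-α⁻ r⁻)) lab'≡0)))

  deleteRootEdge : IsPatch (nonatomic _ B) → LMap d
  deleteRootEdge patch = record
    { σ = injection⇒permutation σ⁻ σ⁻-inj ; α = α⁻ ; α-invol = α⁻-invol ; α-fpf = α⁻-fpf ; r = r⁻ ; lab = lab⁻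
    ; connected = λ h → reach-e⁻¹ (connected (e h))
    ; planar = suc-injective (suc-injective (trans (sym euler) (LMap.planar B)))
    ; lab-vertex = lab⁻-vertex ; lab-edge = lab⁻-edge ; lab-root = lab⁻-root patch , lab⁻-coroot }

  pendant : (patch : IsPatch (nonatomic _ B)) → PendantRootEdge (deleteRootEdge patch) B
  pendant patch = record { insertion = insertion ; lab-e = λ _ → refl }

-- The single-edge map (darts 0 and 1 labelled 0 and 1) is the C-patch that
-- corresponds to the atomic patch.

α₁ : Fin 2 → Fin 2
α₁ fz      = fs fz
α₁ (fs fz) = fz

lab₁ : Fin 2 → ℤ
lab₁ fz      = 0ℤ
lab₁ (fs fz) = 1ℤ

singleEdge : LMap 2
singleEdge = record
  { σ = Data.Fin.Permutation.id ; α = α₁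
  ; α-invol = λ { fz → refl ; (fs fz) → refl }
  ; α-fpf = λ { fz () ; (fs fz) () }
  ; r = fz ; lab = lab₁
  ; connected = λ { fz → base ; (fs fz) → viaa base }
  ; planar = refl
  ; lab-vertex = λ _ → refl
  ; lab-edge = λ { fz → inj₁ refl ; (fs fz) → inj₂ refl }
  ; lab-root = refl , refl }

singleEdge-cpatch : IsCPatch (nonatomic 2 singleEdge)
singleEdge-cpatch = (quadrangles , alternating) ,
  (λ h 0→h → subst (λ z → lab₁ (α₁ z) ≡ 1ℤ) (sym (fixed-orbit id refl 0→h)) refl) ,
  (λ h 0→h _ → fixed-orbit id refl 0→h)
  where
  quadrangles : ∀ h → ¬ InOrbit α₁ fz h → orbitSize α₁ h ≡ 4
  quadrangles fz      ¬0→h = ⊥-elim (¬0→h (0 , refl))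
  quadrangles (fs fz) ¬0→h = ⊥-elim (¬0→h (1 , refl))
  alternating : ∀ h → InOrbit α₁ fz h → ZeroOneEdge (lab₁ h) (lab₁ (α₁ h))
  alternating fz      _ = inj₁ (refl , refl)
  alternating (fs fz) _ = inj₂ (refl , refl)

module SingleEdgeRecognition {d : ℕ} (B : LMap (suc (suc d)))
  (σ-x : RootDegreeOne B) (σ-y : CoRootDegreeOne B) where

  open LMap B using (α-invol; α-fpf; connected; lab-root) renaming (σ to σB; α to α'; r to x; φ to φB)

  x≢α'x : x ≢ α' x
  x≢α'x eq = α-fpf x (sym eq)

  open Complement x (punchOut x≢α'x)

  y≡α'x : y ≡ α' x
  y≡α'x = punchIn-punchOut x≢α'x

  root-edge-only : ∀ {z} → Reach (σB ⟨$⟩ʳ_) α' x z → z ≡ x ⊎ z ≡ y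
  root-edge-only base = inj₁ refl
  root-edge-only (vias reach) with root-edge-only reach
  ... | inj₁ refl = inj₁ σ-x
  ... | inj₂ refl = inj₂ (trans (cong (σB ⟨$⟩ʳ_) y≡α'x) (trans σ-y (sym y≡α'x)))
  root-edge-only (viaa reach) with root-edge-only reach
  ... | inj₁ refl = inj₂ (sym y≡α'x)
  ... | inj₂ refl = inj₁ (trans (cong α' y≡α'x) (α-invol x))

  no-other-dart : Fin d → ⊥
  no-other-dart h with root-edge-only (connected (e h))
  ... | inj₁ eq = e≢x h eq
  ... | inj₂ eq = e≢y h eq

  module F = Orbits φB (φ-injective B)

  σ-y' : σB ⟨$⟩ʳ y ≡ y
  σ-y' = trans (cong (σB ⟨$⟩ʳ_) y≡α'x) (trans σ-y (sym y≡α'x))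

  in-root-face : ∀ z → InOrbit φB x z
  in-root-face = elim (InOrbit φB x) (orbit-refl φB x) (1 , trans (cong (σB ⟨$⟩ʳ_) (sym y≡α'x)) σ-y')
                      (⊥-elim ∘ no-other-dart)

  inner-faces : innerFaces (nonatomic _ B) ≡ 0
  inner-faces = cong (_∸ 1) (trans (F.numCycles-split x)
    (cong suc (count-none (F.isLeast? ∩? ∁? (F.inOrbit? x)) (λ z least → proj₂ least (in-root-face z)))))

  outer-degree : outerDegree (nonatomic _ B) ≡ 2
  outer-degree = trans (F.orbitSize-count x) (trans (count-complement (F.inOrbit? x))
    (cong₃ (ind-yes (F.inOrbit? x x) (in-root-face x)) (ind-yes (F.inOrbit? x y) (in-root-face y))
           (count-none _ (λ h _ → no-other-dart h))))
    where
    cong₃ : ∀ {a b c a' b' c'} → a ≡ a' → b ≡ b' → c ≡ c' → a + b + c ≡ a' + b' + c'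
    cong₃ refl refl refl = refl

  ≅singleEdge : Isomorphism singleEdge B
  ≅singleEdge = record { π = permutation F G F∘G G∘F ; π-σ = F-σ ; π-α = F-α ; π-r = refl ; π-lab = F-lab }
    where
    F : Fin 2 → Fin (suc (suc d))
    F fz      = x
    F (fs fz) = y
    G : Fin (suc (suc d)) → Fin 2
    G = cases fz (fs fz) (⊥-elim ∘ no-other-dart)
    F∘G : ∀ z → F (G z) ≡ z
    F∘G = elim (λ z → F (G z) ≡ z) (cong F (cases-x _ _ _)) (cong F (cases-y _ _ _)) (⊥-elim ∘ no-other-dart)
    G∘F : ∀ h → G (F h) ≡ h
    G∘F fz      = cases-x _ _ _
    G∘F (fs fz) = cases-y _ _ _
    F-σ : ∀ h → F h ≡ σB ⟨$⟩ʳ F h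
    F-σ fz      = sym σ-x
    F-σ (fs fz) = sym σ-y'
    F-α : ∀ h → F (α₁ h) ≡ α' (F h)
    F-α fz      = y≡α'x
    F-α (fs fz) = trans (sym (α-invol x)) (cong α' (sym y≡α'x))
    F-lab : ∀ h → LMap.lab B (F h) ≡ lab₁ h
    F-lab fz      = proj₁ lab-root
    F-lab (fs fz) = trans (cong (LMap.lab B) y≡α'x) (proj₂ lab-root)

no-map-on-zero-darts : LMap 0 → ⊥
no-map-on-zero-darts M = ¬Fin0 (LMap.r M)

no-map-on-one-dart : LMap 1 → ⊥
no-map-on-one-dart M = LMap.α-fpf M fz (one-element (LMap.α M fz) fz)
  where
  one-element : (i j : Fin 1) → i ≡ j
  one-element fz fz = refl

-- The root face always contains the root dart.
outer-degree-nonzero : ∀ {d} (M : LMap d) → outerDegree (nonatomic d M) ≢ 0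
outer-degree-nonzero {zero}  M _  = no-map-on-zero-darts M
outer-degree-nonzero {suc d} M eq =
  1+n≢0 (trans (sym (count-witness (F.inOrbit? r) (orbit-refl _ r))) (trans (sym (F.orbitSize-count r)) eq))
  where
  r : Fin (suc d)
  r = LMap.r M
  module F = Orbits (LMap.φ M) (φ-injective M)

degree-one-fixed : ∀ {d} (M : LMap d) → rootDegree (nonatomic d M) ≡ 1 → RootDegreeOne M
degree-one-fixed {d} M deg with LMap.σ M ⟨$⟩ʳ LMap.r M ≟ LMap.r M
... | yes fixed = fixed
... | no moved  = ⊥-elim (<-irrefl refl (≤-trans
        (count-two (V.inOrbit? (LMap.r M)) (moved ∘ sym) (orbit-refl σ (LMap.r M)) (orbit-step σ (LMap.r M)))
        (≤-reflexive (trans (sym (V.orbitSize-count (LMap.r M))) deg))))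
  where
  σ : Fin d → Fin d
  σ = LMap.σ M ⟨$⟩ʳ_
  module V = Orbits σ (permutation-injective (LMap.σ M))

-- Whether deleting the root edge leaves the atomic map is decidable and
-- invariant under isomorphism.
coRootDegreeOne? : ∀ {d} (B : LMap d) → Dec (CoRootDegreeOne B)
coRootDegreeOne? B = LMap.σ B ⟨$⟩ʳ LMap.α B (LMap.r B) ≟ LMap.α B (LMap.r B)

coRootDegreeOne-iso : ∀ {d d'} {B : LMap d} {B' : LMap d'} → Isomorphism B B' → CoRootDegreeOne B → CoRootDegreeOne B'
coRootDegreeOne-iso {B = B} {B'} iso fixed =
  trans (cong (LMap.σ B' ⟨$⟩ʳ_) (sym π-coroot)) (trans (sym (π-σ _)) (trans (cong (π ⟨$⟩ʳ_) fixed) π-coroot))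
  where
  open Isomorphism iso
  π-coroot : π ⟨$⟩ʳ LMap.α B (LMap.r B) ≡ LMap.α B' (LMap.r B')
  π-coroot = trans (π-α _) (cong (LMap.α B') π-r)

coRootDegreeOne-iso⁻¹ : ∀ {d d'} {B : LMap d} {B' : LMap d'} → Isomorphism B B' → CoRootDegreeOne B' → CoRootDegreeOne B
coRootDegreeOne-iso⁻¹ {B = B} {B'} iso fixed = permutation-injective π
  (trans (π-σ _) (trans (cong (LMap.σ B' ⟨$⟩ʳ_) π-coroot) (trans fixed (sym π-coroot))))
  where
  open Isomorphism iso
  π-coroot : π ⟨$⟩ʳ LMap.α B (LMap.r B) ≡ LMap.α B' (LMap.r B')
  π-coroot = trans (π-α _) (cong (LMap.α B') π-r)

module Bijection (n k : ℕ) where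

  double-suc : ∀ m → 2 + 2 * m ≡ 2 * suc m
  double-suc m = sym (*-suc 2 m)

  added-cpatch : ∀ {d} (M : LMap d) → PatchNK n k (nonatomic d M) →
    CPatchNJK n 1 (suc k) (nonatomic _ (AddRootEdge.addRootEdge M))
  added-cpatch M (patch , inner , outer) =
    cpatch⇒ patch , trans inner-faces inner , root-degree , trans outer-degree (trans (cong (2 +_) outer) (double-suc k))
    where open PendantRootEdgeProperties (AddRootEdge.pendant M)

  to : ∀ M → PatchNK n k M → Σ LabelledMap (CPatchNJK n 1 (suc k))
  to atomic (_ , inner , outer) =
    nonatomic 2 singleEdge , singleEdge-cpatch , inner , refl , trans (cong (2 +_) outer) (double-suc k)
  to (nonatomic d M) p = nonatomic _ (AddRootEdge.addRootEdge M) , added-cpatch M p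

  deleted-patch : ∀ {d} (B : LMap (suc (suc d))) (σ-x : RootDegreeOne B) (σ-y≢y : ¬ CoRootDegreeOne B)
    (patch : IsPatch (nonatomic _ B)) → innerFaces (nonatomic _ B) ≡ n → outerDegree (nonatomic _ B) ≡ 2 * suc k →
    PatchNK n k (nonatomic d (DeleteRootEdge.deleteRootEdge B σ-x σ-y≢y patch))
  deleted-patch B σ-x σ-y≢y patch inner outer =
    patch⇐ patch , trans (sym inner-faces) inner ,
    +-cancelˡ-≡ 2 _ _ (trans (sym outer-degree) (trans outer (sym (double-suc k))))
    where open PendantRootEdgeProperties (DeleteRootEdge.pendant B σ-x σ-y≢y patch)

  delete : ∀ {d} (B : LMap (suc (suc d))) → CPatchNJK n 1 (suc k) (nonatomic _ B) →
    Dec (CoRootDegreeOne B) → Σ LabelledMap (PatchNK n k)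
  delete B (_ , inner , degree , outer) (yes σ-y) =
    atomic , _ , trans (sym inner-faces) inner ,
    +-cancelˡ-≡ 2 _ _ (trans (sym outer-degree) (trans outer (sym (double-suc k))))
    where open SingleEdgeRecognition B (degree-one-fixed B degree) σ-y
  delete B ((patch , _) , inner , degree , outer) (no σ-y≢y) =
    nonatomic _ (DeleteRootEdge.deleteRootEdge B (degree-one-fixed B degree) σ-y≢y patch) ,
    deleted-patch B (degree-one-fixed B degree) σ-y≢y patch inner outer

  from : ∀ M → CPatchNJK n 1 (suc k) M → Σ LabelledMap (PatchNK n k)
  from atomic (() , _)
  from (nonatomic 0 B) _ = ⊥-elim (no-map-on-zero-darts B)
  from (nonatomic 1 B) _ = ⊥-elim (no-map-on-one-dart B)
  from (nonatomic (suc (suc d)) B) q = delete B q (coRootDegreeOne? B)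

  to-cong : ∀ M M' (p : PatchNK n k M) (p' : PatchNK n k M') → M ≅ M' → proj₁ (to M p) ≅ proj₁ (to M' p')
  to-cong atomic atomic _ _ atomic≅ = Isomorphism.isomorphic (identity singleEdge)
  to-cong (nonatomic d M) (nonatomic d' M') _ _ iso =
    Isomorphism.isomorphic (extend-iso (AddRootEdge.pendant M) (AddRootEdge.pendant M') (isomorphism iso))

  delete-cong : ∀ {d d'} (B : LMap (suc (suc d))) (B' : LMap (suc (suc d')))
    (q : CPatchNJK n 1 (suc k) (nonatomic _ B)) (q' : CPatchNJK n 1 (suc k) (nonatomic _ B'))
    (dec : Dec (CoRootDegreeOne B)) (dec' : Dec (CoRootDegreeOne B')) →
    Isomorphism B B' → proj₁ (delete B q dec) ≅ proj₁ (delete B' q' dec')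
  delete-cong B B' _ _ (yes _) (yes _) iso = atomic≅
  delete-cong B B' ((patch , _) , _ , degree , _) ((patch' , _) , _ , degree' , _) (no ne) (no ne') iso =
    Isomorphism.isomorphic (restrict-iso (DeleteRootEdge.pendant B (degree-one-fixed B degree) ne patch)
                                         (DeleteRootEdge.pendant B' (degree-one-fixed B' degree') ne' patch') iso)
  delete-cong B B' _ _ (yes fixed) (no ne') iso = ⊥-elim (ne' (coRootDegreeOne-iso iso fixed))
  delete-cong B B' _ _ (no ne) (yes fixed') iso = ⊥-elim (ne (coRootDegreeOne-iso⁻¹ iso fixed'))

  from-cong : ∀ M M' (p : CPatchNJK n 1 (suc k) M) (p' : CPatchNJK n 1 (suc k) M') → M ≅ M' →
    proj₁ (from M p) ≅ proj₁ (from M' p')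
  from-cong atomic _ (() , _) _ _
  from-cong (nonatomic 0 B) _ _ _ _ = ⊥-elim (no-map-on-zero-darts B)
  from-cong (nonatomic 1 B) _ _ _ _ = ⊥-elim (no-map-on-one-dart B)
  from-cong (nonatomic (suc (suc d)) B) (nonatomic 0 B') _ _ _ = ⊥-elim (no-map-on-zero-darts B')
  from-cong (nonatomic (suc (suc d)) B) (nonatomic 1 B') _ _ _ = ⊥-elim (no-map-on-one-dart B')
  from-cong (nonatomic (suc (suc d)) B) (nonatomic (suc (suc d')) B') q q' iso =
    delete-cong B B' q q' (coRootDegreeOne? B) (coRootDegreeOne? B') (isomorphism iso)

  from-to : ∀ M (p : PatchNK n k M) → proj₁ (from (proj₁ (to M p)) (proj₂ (to M p))) ≅ M
  from-to atomic _ = atomic≅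
  from-to (nonatomic d M) p = deleted-added (proj₂ (to (nonatomic d M) p))
    where
    deleted-added : (q : CPatchNJK n 1 (suc k) (nonatomic _ (AddRootEdge.addRootEdge M))) →
      proj₁ (from (nonatomic _ (AddRootEdge.addRootEdge M)) q) ≅ nonatomic d M
    deleted-added ((patch , _) , _) = Isomorphism.isomorphic
      (restrict-iso (DeleteRootEdge.pendant (AddRootEdge.addRootEdge M) _ _ patch) (AddRootEdge.pendant M)
                    (identity (AddRootEdge.addRootEdge M)))

  added-deleted : ∀ {d} (B : LMap (suc (suc d))) (q : CPatchNJK n 1 (suc k) (nonatomic _ B))
    (dec : Dec (CoRootDegreeOne B)) →
    proj₁ (to (proj₁ (delete B q dec)) (proj₂ (delete B q dec))) ≅ nonatomic _ B
  added-deleted B (_ , _ , degree , _) (yes σ-y) =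
    Isomorphism.isomorphic (SingleEdgeRecognition.≅singleEdge B (degree-one-fixed B degree) σ-y)
  added-deleted B ((patch , _) , _ , degree , _) (no σ-y≢y) = Isomorphism.isomorphic
    (extend-iso (AddRootEdge.pendant (DeleteRootEdge.deleteRootEdge B (degree-one-fixed B degree) σ-y≢y patch))
                (DeleteRootEdge.pendant B (degree-one-fixed B degree) σ-y≢y patch)
                (identity (DeleteRootEdge.deleteRootEdge B (degree-one-fixed B degree) σ-y≢y patch)))

  to-from : ∀ M (p : CPatchNJK n 1 (suc k) M) → proj₁ (to (proj₁ (from M p)) (proj₂ (from M p))) ≅ M
  to-from atomic (() , _)
  to-from (nonatomic 0 B) _ = ⊥-elim (no-map-on-zero-darts B)
  to-from (nonatomic 1 B) _ = ⊥-elim (no-map-on-one-dart B)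
  to-from (nonatomic (suc (suc d)) B) q = added-deleted B q (coRootDegreeOne? B)

  bijection : ClassBijection (PatchNK n k) (CPatchNJK n 1 (suc k))
  bijection = record
    { to = to ; from = from ; to-cong = to-cong ; from-cong = from-cong ; from-to = from-to ; to-from = to-from }

-- Coefficientwise: for every n
-- and k, patches with n inner quadrangles and outer degree 2k correspond
-- bijectively (up to isomorphism) to C-patches with n inner quadrangles,
-- root degree 1 and outer degree 2(k + 1); and no C-patch has outer degree
-- 0, so [x¹ y⁰] C = 0.

lemma7 : (∀ n k → ClassBijection (PatchNK n k) (CPatchNJK n 1 (suc k)))
         × (∀ n M → ¬ CPatchNJK n 1 0 M)
lemma7 = Bijection.bijection , no-outer-degree-zero
  where
  no-outer-degree-zero : ∀ n M → ¬ CPatchNJK n 1 0 M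
  no-outer-degree-zero n atomic          (() , _)
  no-outer-degree-zero n (nonatomic d M) (_ , _ , _ , outer) = outer-degree-nonzero M outer
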